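{- A $(p,q)$-clan $\gamma$ is uniquely determined by its rank numbers $\gamma(i;+)$, $\gamma(i;-)$ ($1\le i\le n$) and $\gamma(i;j)$ ($1\le i<j\le n$), where $n=p+q$. (Clans differing only by a relabeling of the natural numbers are regarded as the same clan.)
   Context: A $(p,q)$-clan is an involution of $\{1,\dots,n\}$ with each fixed point decorated by $+$ or $-$, such that (number of $+$) $-$ (number of $-$) $=p-q$; written as a string $c_1\cdots c_n$ with $c_i$ the sign of a fixed point $i$ and $c_i=c_j\in\mathbb{N}$ for each swapped pair $\{i,j\}$ (distinct numbers for distinct pairs; only the underlying signed involution matters). $\gamma(i;+)$ (resp. $\gamma(i;-)$) is the number of $+$ (resp. $-$) signs plus the number of pairs of equal natural numbers with both entries among $c_1\cdots c_i$; for $i<j$, $\gamma(i;j)$ is the number of pairs $c_s=c_t\in\mathbb{N}$ with $s\le i<j<t$. -}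

module Defs where

open import Data.Nat using (ℕ; zero; suc; _+_; _≤_; _<_; _≤ᵇ_; _<ᵇ_)
open import Data.Nat.Properties using (_≟_)
open import Data.Fin using (Fin; toℕ)
open import Data.Fin.Properties using () renaming (_≟_ to _≟ᶠ_)
open import Data.Bool using (Bool; true; false; _∧_; if_then_else_)
open import Data.List using (List; sum; map; filter; length)
open import Relation.Nullary.Decidable using (⌊_⌋)
open import Relation.Binary.PropositionalEquality using (_≡_)
open import Data.Integer using (ℤ; +_; _-_)

import Data.List as L

open import Data.List using () renaming (allFin to allFinL)

data Sign : Set where
  plus minus : Sign

isPlus : Sign → Bool
isPlus plus = true
isPlus minus = false

isMinus : Sign → Bool
isMinus plus = false
isMinus minus = true

count : {n : ℕ} → (Fin n → Bool) → ℕ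
count {n} P = length (L.filterᵇ P (allFinL n))

-- A signed involution of {1,…,n} (positions are 0-based: Fin n).
-- `inv` is the underlying involution; `sign k` is the decoration of k,
-- which is only meaningful when k is a fixed point of `inv`.
record SignedInvolution (n : ℕ) : Set where
  field
    inv      : Fin n → Fin n
    involutive : ∀ k → inv (inv k) ≡ k
    sign     : Fin n → Sign

  isFixed : Fin n → Bool
  isFixed k = ⌊ inv k ≟ᶠ k ⌋

  nPlus : ℕ
  nPlus = count (λ k → isFixed k ∧ isPlus (sign k))

  nMinus : ℕ
  nMinus = count (λ k → isFixed k ∧ isMinus (sign k))

open SignedInvolution public

record Clan (p q : ℕ) : Set where
  field
    invol : SignedInvolution (p + q)
    balance : (+ nPlus invol) - (+ nMinus invol) ≡ (+ p) - (+ q)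

open Clan public

record SameClan {p q : ℕ} (γ δ : Clan p q) : Set where
  field
    sameInv  : ∀ k → inv (invol γ) k ≡ inv (invol δ) k
    sameSign : ∀ k → inv (invol γ) k ≡ k → sign (invol γ) k ≡ sign (invol δ) k

-- Rank numbers. Positions k : Fin n correspond to 1 + toℕ k ∈ {1,…,n}.
-- "k among c_1 … c_i" means 1 + toℕ k ≤ i, i.e. toℕ k < i.
module _ {p q : ℕ} (γ : Clan p q) where
  private
    σ = invol γ

  -- γ(i;+) : number of + signs among c_1..c_i plus number of pairs with
  -- both entries among c_1..c_i (each pair counted once via its smaller entry).
  rankPlus : ℕ → ℕ
  rankPlus i =
    count (λ k → (toℕ k <ᵇ i) ∧ isFixed σ k ∧ isPlus (sign σ k))
    + count (λ k → (toℕ k <ᵇ toℕ (inv σ k)) ∧ (toℕ (inv σ k) <ᵇ i))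

  rankMinus : ℕ → ℕ
  rankMinus i =
    count (λ k → (toℕ k <ᵇ i) ∧ isFixed σ k ∧ isMinus (sign σ k))
    + count (λ k → (toℕ k <ᵇ toℕ (inv σ k)) ∧ (toℕ (inv σ k) <ᵇ i))

  -- γ(i;j) for i < j : number of pairs c_s = c_t with s ≤ i < j < t.
  -- (1-based s = 1 + toℕ k, t = 1 + toℕ (inv k)).
  rankPair : ℕ → ℕ → ℕ
  rankPair i j = count (λ k → (toℕ k <ᵇ i) ∧ (j <ᵇ suc (toℕ (inv σ k))))

-- Read γ as a string c₁ ⋯ cₙ: each position is a + sign, a − sign, the opening
-- (left) entry of a pair or its closing (right) entry. Going from i − 1 to i,
-- γ(·;+) grows by 1 exactly when cᵢ is + or closes a pair, and γ(·;−) exactly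
-- when cᵢ is − or closes a pair; so the two rank sequences determine the kind
-- of every position, hence all fixed points with their signs. If k opens a pair
-- with partner t, then γ(k;j) − γ(k−1;j) = 1 exactly for k < j < t, so the
-- numbers γ(·;·) locate t, and the pairs are determined as well.
module Submission where

open import Defs
open import Data.Nat using (ℕ; _+_; _≤_; _<_)
open import Relation.Binary.PropositionalEquality using (_≡_)

open import Data.Bool using (Bool; true; false; _∧_; if_then_else_; T)
open import Data.Bool.Properties using (∧-comm; ∧-identityʳ; ∧-zeroʳ)
open import Data.Fin as Fin using (Fin; toℕ)
open import Data.Fin.Properties using (toℕ-injective; toℕ<n) renaming (_≟_ to _≟ᶠ_; suc-injective to fsuc-injective)
open import Data.List using (length; filterᵇ; tabulate)
open import Data.Nat using (zero; suc; _<ᵇ_; z≤n; s≤s; _≤?_)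
open import Data.Nat.Properties
  using (_≟_; +-identityʳ; +-cancelˡ-≡; <ᵇ⇒<; <⇒<ᵇ; n<1+n; <⇒≤; <-irrefl; ≤-<-trans; ≤-antisym;
         ≤-pred; ≰⇒>; ≤∧≢⇒<; ≮⇒≥; <⇒≯; <-trans)
open import Data.Product using (_×_; _,_; proj₁; proj₂)
open import Function using (_∘_)
open import Relation.Binary.PropositionalEquality using (refl; sym; trans; cong; cong₂; subst; _≢_; module ≡-Reasoning)
open import Relation.Nullary using (yes; no; does; contradiction)
open import Relation.Nullary.Decidable using (dec-true; dec-false)
import Data.Nat.Properties as ℕ
open import Algebra.Properties.CommutativeSemigroup ℕ.+-commutativeSemigroup using (interchange)

open ≡-Reasoning

bit : Bool → ℕ
bit false = 0
bit true  = 1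

bit-injective : ∀ {a b} → bit a ≡ bit b → a ≡ b
bit-injective {false} {false} _ = refl
bit-injective {true}  {true}  _ = refl

<ᵇ-irrefl : ∀ a → (a <ᵇ a) ≡ false
<ᵇ-irrefl zero    = refl
<ᵇ-irrefl (suc a) = <ᵇ-irrefl a

bit-<ᵇ-suc : ∀ a i → bit (a <ᵇ suc i) ≡ bit (a <ᵇ i) + bit (does (a ≟ i))
bit-<ᵇ-suc zero    zero    = refl
bit-<ᵇ-suc zero    (suc i) = refl
bit-<ᵇ-suc (suc a) zero    = refl
bit-<ᵇ-suc (suc a) (suc i) = bit-<ᵇ-suc a i

bit-∧-<ᵇ-suc : ∀ b a i → bit (b ∧ (a <ᵇ suc i)) ≡ bit (b ∧ (a <ᵇ i)) + bit (b ∧ does (a ≟ i))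
bit-∧-<ᵇ-suc false a i = refl
bit-∧-<ᵇ-suc true  a i = bit-<ᵇ-suc a i

count-tabulate : ∀ {a} {A : Set a} {n} (P : A → Bool) (f : Fin n → A) →
                 length (filterᵇ P (tabulate f)) ≡ count (P ∘ f)
count-tabulate {n = zero}  P f = refl
count-tabulate {n = suc n} P f with P (f Fin.zero)
... | true  = cong suc (trans (count-tabulate P (f ∘ Fin.suc)) (sym (count-tabulate (P ∘ f) Fin.suc)))
... | false = trans (count-tabulate P (f ∘ Fin.suc)) (sym (count-tabulate (P ∘ f) Fin.suc))

count-suc : ∀ {n} (P : Fin (suc n) → Bool) → count P ≡ bit (P Fin.zero) + count (P ∘ Fin.suc)
count-suc P with P Fin.zero
... | true  = cong suc (count-tabulate P Fin.suc)
... | false = count-tabulate P Fin.suc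

count-cong : ∀ {n} {P Q : Fin n → Bool} → (∀ k → P k ≡ Q k) → count P ≡ count Q
count-cong {zero}  eq = refl
count-cong {suc n} {P} {Q} eq = begin
  count P                                ≡⟨ count-suc P ⟩
  bit (P Fin.zero) + count (P ∘ Fin.suc) ≡⟨ cong₂ _+_ (cong bit (eq Fin.zero)) (count-cong (eq ∘ Fin.suc)) ⟩
  bit (Q Fin.zero) + count (Q ∘ Fin.suc) ≡⟨ count-suc Q ⟨
  count Q                                ∎

count-+ : ∀ {n} {P Q R : Fin n → Bool} → (∀ k → bit (P k) ≡ bit (Q k) + bit (R k)) →
          count P ≡ count Q + count R
count-+ {zero}  eq = refl
count-+ {suc n} {P} {Q} {R} eq = begin
  count P                                ≡⟨ count-suc P ⟩
  bit (P Fin.zero) + count (P ∘ Fin.suc) ≡⟨ cong₂ _+_ (eq Fin.zero) (count-+ (eq ∘ Fin.suc)) ⟩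
  (bit (Q Fin.zero) + bit (R Fin.zero)) + (count (Q ∘ Fin.suc) + count (R ∘ Fin.suc))
    ≡⟨ interchange (bit (Q Fin.zero)) _ _ _ ⟩
  (bit (Q Fin.zero) + count (Q ∘ Fin.suc)) + (bit (R Fin.zero) + count (R ∘ Fin.suc))
    ≡⟨ cong₂ _+_ (count-suc Q) (count-suc R) ⟨
  count Q + count R ∎

count-none : ∀ {n} {P : Fin n → Bool} → (∀ k → P k ≡ false) → count P ≡ 0
count-none {zero}  none = refl
count-none {suc n} {P} none = begin
  count P                                ≡⟨ count-suc P ⟩
  bit (P Fin.zero) + count (P ∘ Fin.suc) ≡⟨ cong₂ _+_ (cong bit (none Fin.zero)) (count-none (none ∘ Fin.suc)) ⟩
  0                                      ∎

count-unique : ∀ {n} {P : Fin n → Bool} k₀ → (∀ k → k ≢ k₀ → P k ≡ false) → count P ≡ bit (P k₀)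
count-unique {suc n} {P} Fin.zero off = begin
  count P                                ≡⟨ count-suc P ⟩
  bit (P Fin.zero) + count (P ∘ Fin.suc) ≡⟨ cong (bit (P Fin.zero) +_) (count-none (λ k → off (Fin.suc k) λ ())) ⟩
  bit (P Fin.zero) + 0                   ≡⟨ +-identityʳ _ ⟩
  bit (P Fin.zero)                       ∎
count-unique {suc n} {P} (Fin.suc k₀) off = begin
  count P                                ≡⟨ count-suc P ⟩
  bit (P Fin.zero) + count (P ∘ Fin.suc) ≡⟨ cong₂ _+_ (cong bit (off Fin.zero λ ()))
                                             (count-unique k₀ (λ k k≢k₀ → off (Fin.suc k) (k≢k₀ ∘ fsuc-injective))) ⟩
  bit (P (Fin.suc k₀))                   ∎

count-<ᵇ-suc : ∀ {n} (X : Fin n → Bool) (f : Fin n → ℕ) {i} k₀ → f k₀ ≡ i → (∀ k → f k ≡ i → k ≡ k₀) →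
               count (λ k → X k ∧ (f k <ᵇ suc i)) ≡ count (λ k → X k ∧ (f k <ᵇ i)) + bit (X k₀)
count-<ᵇ-suc X f {i} k₀ fk₀≡i unique = begin
  count (λ k → X k ∧ (f k <ᵇ suc i))              ≡⟨ count-+ (λ k → bit-∧-<ᵇ-suc (X k) (f k) i) ⟩
  below + count (λ k → X k ∧ does (f k ≟ i))     ≡⟨ cong (below +_) (count-unique k₀ off) ⟩
  below + bit (X k₀ ∧ does (f k₀ ≟ i))           ≡⟨ cong (λ b → below + bit b) at-k₀ ⟩
  below + bit (X k₀)                             ∎
  where
  below : ℕ
  below = count (λ k → X k ∧ (f k <ᵇ i))

  off : ∀ k → k ≢ k₀ → X k ∧ does (f k ≟ i) ≡ false
  off k k≢k₀ = trans (cong (X k ∧_) (dec-false (f k ≟ i) (k≢k₀ ∘ unique k))) (∧-zeroʳ (X k))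

  at-k₀ : X k₀ ∧ does (f k₀ ≟ i) ≡ X k₀
  at-k₀ = trans (cong (X k₀ ∧_) (dec-true (f k₀ ≟ i) fk₀≡i)) (∧-identityʳ (X k₀))

count-prefix-suc : ∀ {n} (X : Fin n → Bool) m →
                   count (λ k → (toℕ k <ᵇ suc (toℕ m)) ∧ X k) ≡ count (λ k → (toℕ k <ᵇ toℕ m) ∧ X k) + bit (X m)
count-prefix-suc X m = begin
  count (λ k → (toℕ k <ᵇ suc (toℕ m)) ∧ X k)           ≡⟨ count-cong (λ k → ∧-comm (toℕ k <ᵇ suc (toℕ m)) (X k)) ⟩
  count (λ k → X k ∧ (toℕ k <ᵇ suc (toℕ m)))           ≡⟨ count-<ᵇ-suc X toℕ m refl (λ k → toℕ-injective) ⟩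
  count (λ k → X k ∧ (toℕ k <ᵇ toℕ m)) + bit (X m)     ≡⟨ cong (_+ bit (X m)) (count-cong (λ k → ∧-comm (X k) (toℕ k <ᵇ toℕ m))) ⟩
  count (λ k → (toℕ k <ᵇ toℕ m) ∧ X k) + bit (X m)     ∎

≤-by-cuts : ∀ {lo a b N} → lo ≤ b → a ≤ N →
            (∀ j → lo < j → j ≤ N → (j <ᵇ suc a) ≡ (j <ᵇ suc b)) → a ≤ b
≤-by-cuts {a = a} {b} lo≤b a≤N cuts with a ≤? b
... | yes a≤b = a≤b
... | no  a≰b = contradiction (≤-pred (<ᵇ⇒< a (suc b) a<ᵇ1+b)) a≰b
  where
  a<ᵇ1+b : T (a <ᵇ suc b)
  a<ᵇ1+b = subst T (cuts a (≤-<-trans lo≤b (≰⇒> a≰b)) a≤N) (<⇒<ᵇ (n<1+n a))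

≡-by-cuts : ∀ {lo a b N} → lo ≤ a → lo ≤ b → a ≤ N → b ≤ N →
            (∀ j → lo < j → j ≤ N → (j <ᵇ suc a) ≡ (j <ᵇ suc b)) → a ≡ b
≡-by-cuts lo≤a lo≤b a≤N b≤N cuts =
  ≤-antisym (≤-by-cuts lo≤b a≤N cuts) (≤-by-cuts lo≤a b≤N (λ j lo<j j≤N → sym (cuts j lo<j j≤N)))

data Kind : Set where
  fixed           : Sign → Kind
  opening closing : Kind

jump : (Sign → Bool) → Kind → ℕ
jump P (fixed s) = bit (P s)
jump P opening   = 0
jump P closing   = 1

kindFromJumps : ℕ → ℕ → Kind
kindFromJumps 1 0 = fixed plus
kindFromJumps 0 1 = fixed minus
kindFromJumps 1 1 = closing
kindFromJumps _ _ = opening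

kindFromJumps-jump : ∀ κ → kindFromJumps (jump isPlus κ) (jump isMinus κ) ≡ κ
kindFromJumps-jump (fixed plus)  = refl
kindFromJumps-jump (fixed minus) = refl
kindFromJumps-jump opening       = refl
kindFromJumps-jump closing       = refl

jump-injective : ∀ {κ κ′} → jump isPlus κ ≡ jump isPlus κ′ → jump isMinus κ ≡ jump isMinus κ′ → κ ≡ κ′
jump-injective {κ} {κ′} eq₊ eq₋ = begin
  κ                                                 ≡⟨ kindFromJumps-jump κ ⟨
  kindFromJumps (jump isPlus κ) (jump isMinus κ)    ≡⟨ cong₂ kindFromJumps eq₊ eq₋ ⟩
  kindFromJumps (jump isPlus κ′) (jump isMinus κ′)  ≡⟨ kindFromJumps-jump κ′ ⟩
  κ′                                                ∎

module _ {p q : ℕ} (γ : Clan p q) where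
  private
    σ : SignedInvolution (p + q)
    σ = invol γ

    g : Fin (p + q) → Fin (p + q)
    g = inv σ

  kind : Fin (p + q) → Kind
  kind m with g m ≟ᶠ m
  ... | yes _ = fixed (sign σ m)
  ... | no  _ = if toℕ (g m) <ᵇ toℕ m then closing else opening

  data KindOf (m : Fin (p + q)) : Kind → Set where
    fixed-point : g m ≡ m → KindOf m (fixed (sign σ m))
    opening     : toℕ m < toℕ (g m) → KindOf m opening
    closing     : toℕ (g m) < toℕ m → KindOf m closing

  kindOf-kind : ∀ m → KindOf m (kind m)
  kindOf-kind m with g m ≟ᶠ m
  ... | yes gm≡m = fixed-point gm≡m
  ... | no  gm≢m with toℕ (g m) <ᵇ toℕ m in gm<ᵇm
  ...   | true  = closing (<ᵇ⇒< (toℕ (g m)) (toℕ m) (subst T (sym gm<ᵇm) _))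
  ...   | false = opening (≤∧≢⇒< (≮⇒≥ (λ gm<m → subst T gm<ᵇm (<⇒<ᵇ gm<m)))
                                     (gm≢m ∘ toℕ-injective ∘ sym))

  kind≡fixed⇒fixed-point : ∀ {m s} → kind m ≡ fixed s → g m ≡ m × sign σ m ≡ s
  kind≡fixed⇒fixed-point {m} e with subst (KindOf m) e (kindOf-kind m)
  ... | fixed-point gm≡m = gm≡m , refl

  kind≡opening⇒< : ∀ {m} → kind m ≡ opening → toℕ m < toℕ (g m)
  kind≡opening⇒< {m} e with subst (KindOf m) e (kindOf-kind m)
  ... | opening m<gm = m<gm

  kind≡closing⇒> : ∀ {m} → kind m ≡ closing → toℕ (g m) < toℕ m
  kind≡closing⇒> {m} e with subst (KindOf m) e (kindOf-kind m)
  ... | closing gm<m = gm<m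

  fixed-point⇒kind≡fixed : ∀ {m} → g m ≡ m → kind m ≡ fixed (sign σ m)
  fixed-point⇒kind≡fixed {m} gm≡m with kind m | kindOf-kind m
  ... | _ | fixed-point _  = refl
  ... | _ | opening m<gm   = contradiction m<gm (<-irrefl (cong toℕ (sym gm≡m)))
  ... | _ | closing gm<m   = contradiction gm<m (<-irrefl (cong toℕ gm≡m))

  <⇒kind≡opening : ∀ {m} → toℕ m < toℕ (g m) → kind m ≡ opening
  <⇒kind≡opening {m} m<gm with kind m | kindOf-kind m
  ... | _ | fixed-point gm≡m = contradiction m<gm (<-irrefl (cong toℕ (sym gm≡m)))
  ... | _ | opening _        = refl
  ... | _ | closing gm<m     = contradiction m<gm (<⇒≯ gm<m)

  kind≡closing⇒partner-opening : ∀ {m} → kind m ≡ closing → kind (g m) ≡ opening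
  kind≡closing⇒partner-opening {m} e =
    <⇒kind≡opening (subst (λ x → toℕ (g m) < toℕ x) (sym (involutive σ m)) (kind≡closing⇒> e))

  -- rankPlus γ and rankMinus γ are signedRank isPlus and signedRank isMinus, definitionally.
  signedRank : (Sign → Bool) → ℕ → ℕ
  signedRank P i = count (λ k → (toℕ k <ᵇ i) ∧ isFixed σ k ∧ P (sign σ k))
                 + count (λ k → (toℕ k <ᵇ toℕ (g k)) ∧ (toℕ (g k) <ᵇ i))

  signedRank-zero : ∀ P → signedRank P 0 ≡ 0
  signedRank-zero P = cong₂ _+_ (count-none {p + q} (λ _ → refl)) (count-none (λ k → ∧-zeroʳ (toℕ k <ᵇ toℕ (g k))))

  jump-kind : ∀ P m → bit (isFixed σ m ∧ P (sign σ m)) + bit (toℕ (g m) <ᵇ toℕ m) ≡ jump P (kind m)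
  jump-kind P m with g m ≟ᶠ m
  ... | yes gm≡m rewrite gm≡m | <ᵇ-irrefl (toℕ m) = +-identityʳ (bit (P (sign σ m)))
  ... | no  _ with toℕ (g m) <ᵇ toℕ m
  ...   | true  = refl
  ...   | false = refl

  signedRank-suc : ∀ P m → signedRank P (suc (toℕ m)) ≡ signedRank P (toℕ m) + jump P (kind m)
  signedRank-suc P m = begin
    signedRank P (suc (toℕ m))
      ≡⟨ cong₂ _+_ (count-prefix-suc signed m)
                   (count-<ᵇ-suc opens (toℕ ∘ g) (g m) (cong toℕ (involutive σ m)) partner-unique) ⟩
    (count (λ k → (toℕ k <ᵇ toℕ m) ∧ signed k) + bit (signed m))
      + (count (λ k → opens k ∧ (toℕ (g k) <ᵇ toℕ m)) + bit (opens (g m)))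
      ≡⟨ interchange (count (λ k → (toℕ k <ᵇ toℕ m) ∧ signed k)) (bit (signed m)) _ _ ⟩
    signedRank P (toℕ m) + (bit (signed m) + bit (opens (g m)))
      ≡⟨ cong (λ x → signedRank P (toℕ m) + (bit (signed m) + bit (toℕ (g m) <ᵇ toℕ x))) (involutive σ m) ⟩
    signedRank P (toℕ m) + (bit (signed m) + bit (toℕ (g m) <ᵇ toℕ m))
      ≡⟨ cong (signedRank P (toℕ m) +_) (jump-kind P m) ⟩
    signedRank P (toℕ m) + jump P (kind m)
      ∎
    where
    signed opens : Fin (p + q) → Bool
    signed k = isFixed σ k ∧ P (sign σ k)
    opens  k = toℕ k <ᵇ toℕ (g k)

    partner-unique : ∀ k → toℕ (g k) ≡ toℕ m → k ≡ g m
    partner-unique k gk≡m = trans (sym (involutive σ k)) (cong g (toℕ-injective gk≡m))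

  rankPair-zero : ∀ j → rankPair γ 0 j ≡ 0
  rankPair-zero j = count-none {p + q} (λ _ → refl)

  rankPair-suc : ∀ m j → rankPair γ (suc (toℕ m)) j ≡ rankPair γ (toℕ m) j + bit (j <ᵇ suc (toℕ (g m)))
  rankPair-suc m j = count-prefix-suc (λ k → j <ᵇ suc (toℕ (g k))) m

module _ {p q : ℕ} (γ δ : Clan p q) where

  jump-agree : ∀ P → (∀ i → 1 ≤ i → i ≤ p + q → signedRank γ P i ≡ signedRank δ P i) →
               ∀ m → jump P (kind γ m) ≡ jump P (kind δ m)
  jump-agree P agree m = +-cancelˡ-≡ (signedRank γ P (toℕ m)) _ _ (begin
    signedRank γ P (toℕ m) + jump P (kind γ m)  ≡⟨ signedRank-suc γ P m ⟨
    signedRank γ P (suc (toℕ m))                ≡⟨ agree (suc (toℕ m)) (s≤s z≤n) (toℕ<n m) ⟩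
    signedRank δ P (suc (toℕ m))                ≡⟨ signedRank-suc δ P m ⟩
    signedRank δ P (toℕ m) + jump P (kind δ m)  ≡⟨ cong (_+ jump P (kind δ m)) (agree-at (toℕ m) (<⇒≤ (toℕ<n m))) ⟨
    signedRank γ P (toℕ m) + jump P (kind δ m)  ∎)
    where
    agree-at : ∀ i → i ≤ p + q → signedRank γ P i ≡ signedRank δ P i
    agree-at zero    _ = trans (signedRank-zero γ P) (sym (signedRank-zero δ P))
    agree-at (suc i)   = agree (suc i) (s≤s z≤n)

  opening-partner-agree : (∀ i j → 1 ≤ i → i < j → j ≤ p + q → rankPair γ i j ≡ rankPair δ i j) →
                          ∀ {k} → kind γ k ≡ opening → kind δ k ≡ opening →
                          inv (invol γ) k ≡ inv (invol δ) k
  opening-partner-agree agree {k} γk δk = toℕ-injective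
    (≡-by-cuts (kind≡opening⇒< γ γk) (kind≡opening⇒< δ δk) (<⇒≤ (toℕ<n gk)) (<⇒≤ (toℕ<n hk)) cuts)
    where
    gk hk : Fin (p + q)
    gk = inv (invol γ) k
    hk = inv (invol δ) k

    agree-at : ∀ i j → i < j → j ≤ p + q → rankPair γ i j ≡ rankPair δ i j
    agree-at zero    j _ _ = trans (rankPair-zero γ j) (sym (rankPair-zero δ j))
    agree-at (suc i) j     = agree (suc i) j (s≤s z≤n)

    cuts : ∀ j → suc (toℕ k) < j → j ≤ p + q → (j <ᵇ suc (toℕ gk)) ≡ (j <ᵇ suc (toℕ hk))
    cuts j k+1<j j≤n = bit-injective (+-cancelˡ-≡ (rankPair γ (toℕ k) j) _ _ (begin
      rankPair γ (toℕ k) j + bit (j <ᵇ suc (toℕ gk))  ≡⟨ rankPair-suc γ k j ⟨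
      rankPair γ (suc (toℕ k)) j                      ≡⟨ agree (suc (toℕ k)) j (s≤s z≤n) k+1<j j≤n ⟩
      rankPair δ (suc (toℕ k)) j                      ≡⟨ rankPair-suc δ k j ⟩
      rankPair δ (toℕ k) j + bit (j <ᵇ suc (toℕ hk))  ≡⟨ cong (_+ bit (j <ᵇ suc (toℕ hk))) (agree-at (toℕ k) j (<-trans (n<1+n (toℕ k)) k+1<j) j≤n) ⟨
      rankPair γ (toℕ k) j + bit (j <ᵇ suc (toℕ hk))  ∎))

proposition2p2 : (p q : ℕ) (γ δ : Clan p q)
    → (∀ i → 1 ≤ i → i ≤ p + q → rankPlus γ i ≡ rankPlus δ i)
    → (∀ i → 1 ≤ i → i ≤ p + q → rankMinus γ i ≡ rankMinus δ i)
    → (∀ i j → 1 ≤ i → i < j → j ≤ p + q → rankPair γ i j ≡ rankPair δ i j)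
    → SameClan γ δ
proposition2p2 p q γ δ hP hM hR = record { sameInv = same-inv ; sameSign = same-sign }
  where
  σ τ : SignedInvolution (p + q)
  σ = invol γ
  τ = invol δ

  kind-agree : ∀ {m κ} → kind γ m ≡ κ → kind δ m ≡ κ
  kind-agree {m} e = trans (sym (jump-injective (jump-agree γ δ isPlus hP m) (jump-agree γ δ isMinus hM m))) e

  partner-agree : ∀ {k} → kind γ k ≡ opening → inv σ k ≡ inv τ k
  partner-agree e = opening-partner-agree γ δ hR e (kind-agree e)

  same-inv : ∀ k → inv σ k ≡ inv τ k
  same-inv k with kind γ k in e
  ... | fixed _ = trans (proj₁ (kind≡fixed⇒fixed-point γ e)) (sym (proj₁ (kind≡fixed⇒fixed-point δ (kind-agree e))))
  ... | opening = partner-agree e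
  ... | closing = begin
    inv σ k                  ≡⟨ involutive τ (inv σ k) ⟨
    inv τ (inv τ (inv σ k))  ≡⟨ cong (inv τ) (partner-agree (kind≡closing⇒partner-opening γ e)) ⟨
    inv τ (inv σ (inv σ k))  ≡⟨ cong (inv τ) (involutive σ k) ⟩
    inv τ k                  ∎

  same-sign : ∀ k → inv σ k ≡ k → sign σ k ≡ sign τ k
  same-sign k gk≡k = sym (proj₂ (kind≡fixed⇒fixed-point δ (kind-agree (fixed-point⇒kind≡fixed γ gk≡k))))
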